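{- If $G$ is a banana tree with $\{a_1,\ldots,a_n\}$ the multiset of the sizes of its edge bunches, then $\operatorname{gon}(G)\leq \operatorname{lcm}(a_1,\ldots,a_n)$.
   Context: A banana tree is a connected loopless multigraph whose underlying simple graph is a tree; an edge bunch is the set of all edges joining a given pair of adjacent vertices. $\operatorname{gon}(G)$ denotes the divisorial gonality of $G$, the minimum degree of a divisor of positive rank in the chip-firing (Baker–Norine) divisor theory on $G$. -}

module Defs where

open import Data.Nat as ℕ using (ℕ; zero; suc; _<ᵇ_; _≡ᵇ_)
open import Data.Nat.LCM using (lcm)
open import Data.Bool using (Bool; true; false; if_then_else_; _∧_; not)
open import Data.Fin using (Fin; toℕ)
import Data.Fin as Fin
open import Data.Integer as ℤ using (ℤ; +_; _-_; _*_)
open import Data.List using (List; []; _∷_; _++_; length)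
open import Data.List.Relation.Unary.Unique.Propositional using (Unique)
open import Data.Product using (Σ; ∃; _×_; _,_)
open import Relation.Binary.PropositionalEquality using (_≡_)
open import Data.Unit using (⊤)
open import Data.Empty using (⊥)

-- A finite loopless multigraph on vertex set Fin n:
-- mult u v = number of edges joining u and v (the size of the edge bunch).
record Multigraph (n : ℕ) : Set where
  field
    mult     : Fin n → Fin n → ℕ
    symm     : ∀ u v → mult u v ≡ mult v u
    loopless : ∀ v → mult v v ≡ 0
open Multigraph public

module _ {n : ℕ} (G : Multigraph n) where

  Adj : Fin n → Fin n → Set
  Adj u v = 0 ℕ.< mult G u v

  data Walk : Fin n → Fin n → Set where
    here : ∀ {u} → Walk u u
    step : ∀ {u x v} → Adj u x → Walk x v → Walk u v

  Connected : Set
  Connected = ∀ u v → Walk u v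

  Chain : List (Fin n) → Set
  Chain []           = ⊤
  Chain (x ∷ [])     = ⊤
  Chain (x ∷ y ∷ xs) = Adj x y × Chain (y ∷ xs)

  HasCycle : Set
  HasCycle = Σ (Fin n) λ u → Σ (List (Fin n)) λ xs →
               (2 ℕ.≤ length xs) × Unique (u ∷ xs) × Chain (u ∷ xs ++ u ∷ [])

  -- banana tree: underlying simple graph is a tree (nonempty, connected, acyclic)
  IsBananaTree : Set
  IsBananaTree = (0 ℕ.< n) × Connected × (HasCycle → ⊥)

  -- lcm of the multiset of edge-bunch sizes (one entry per pair u < v of
  -- adjacent vertices); the lcm of the empty multiset is 1.

  lcmFin : ∀ {m} → (Fin m → ℕ) → ℕ
  lcmFin {zero}  f = 1
  lcmFin {suc m} f = lcm (f Fin.zero) (lcmFin (λ i → f (Fin.suc i)))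

  bunchLcm : ℕ
  bunchLcm = lcmFin λ u → lcmFin λ v →
    if (toℕ u <ᵇ toℕ v) ∧ not (mult G u v ≡ᵇ 0) then mult G u v else 1

  sumℤ : ∀ {m} → (Fin m → ℤ) → ℤ
  sumℤ {zero}  f = + 0
  sumℤ {suc m} f = f Fin.zero ℤ.+ sumℤ (λ i → f (Fin.suc i))

  Divisor : Set
  Divisor = Fin n → ℤ

  deg : Divisor → ℤ
  deg D = sumℤ D

  laplacian : (Fin n → ℤ) → Divisor
  laplacian f v = sumℤ λ u → + (mult G v u) * (f v - f u)

  _∼_ : Divisor → Divisor → Set
  D ∼ D' = Σ (Fin n → ℤ) λ f → ∀ v → D' v ≡ D v - laplacian f v

  Effective : Divisor → Set
  Effective D = ∀ v → + 0 ℤ.≤ D v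

  HasPositiveRank : Divisor → Set
  HasPositiveRank D = ∀ (E : Divisor) → Effective E → deg E ≡ + 1 →
                        Σ Divisor λ D' → Effective D' × ((λ v → D v - E v) ∼ D')

  -- gon(G) ≤ k  :⇔  some divisor of positive rank has degree ≤ k
  -- (gon(G) is the minimum degree of a divisor of positive rank)
  gon≤ : ℤ → Set
  gon≤ k = Σ Divisor λ D → HasPositiveRank D × deg D ℤ.≤ k

{-# OPTIONS --safe #-}
-- Put L = bunchLcm G chips on a vertex r. In a tree, deleting the bunch between adjacent p and q
-- splits the vertices into the side S of p and the side of q, and the only edges leaving S are
-- the mult G p q edges of that bunch; so firing S exactly L / mult G p q times moves the L chips
-- from p to q. Moving them along a path from r to v shows L·r - v ∼ L·v - v, which is effective.
module Submission where

open import Defs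
open import Data.Bool using (Bool; true; false; if_then_else_; T; _∧_; not)
open import Data.Empty using (⊥-elim)
open import Data.Fin using (Fin; zero; suc; toℕ)
open import Data.Fin.Properties using (_≟_; any?; pigeonhole; toℕ-injective; suc-injective)
open import Data.Integer using (ℤ; +_; _+_; _-_; _*_; _≤_; +≤+)
import Data.Integer.Properties as ℤP
open import Data.Integer.Tactic.RingSolver using (solve-∀)
open import Data.List using (List; []; _∷_; _++_; length; lookup)
open import Data.List.Membership.Propositional using (_∈_)
open import Data.List.Membership.Propositional.Properties using (∈-lookup)
import Data.List.Membership.DecPropositional as DecMembership
import Data.List.Relation.Unary.All as All
open import Data.List.Relation.Unary.All.Properties using (¬Any⇒All¬)
open import Data.List.Relation.Unary.AllPairs using ([]; _∷_)
open import Data.List.Relation.Unary.Any using (here; there)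
open import Data.List.Relation.Unary.Unique.Propositional using (Unique)
open import Data.Nat as ℕ using (ℕ; zero; suc; _<_; z≤n; s≤s; _<ᵇ_; _≡ᵇ_)
import Data.Nat.Properties as ℕP
open import Data.Nat.Divisibility using (_∣_; divides; ∣-trans)
open import Data.Nat.GCD using (gcd)
open import Data.Nat.LCM using (lcm; m∣lcm[m,n]; n∣lcm[m,n]; gcd*lcm)
open import Data.Product using (Σ; ∃-syntax; _×_; _,_; proj₁)
open import Data.Sum using (_⊎_; inj₁; inj₂)
open import Data.Unit using (tt)
open import Function using (_∘_)
open import Function.Bundles using (mk⇔)
open import Relation.Binary.Construct.Closure.ReflexiveTransitive using (Star; ε; _◅_)
open import Relation.Binary.Definitions using (Decidable; tri<; tri≈; tri>)
open import Relation.Binary.PropositionalEquality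
  using (_≡_; _≢_; _≗_; refl; sym; trans; cong; cong₂; subst; module ≡-Reasoning)
open import Relation.Nullary using (¬_; Dec; yes; no; does)
open import Relation.Nullary.Decidable using (map′; _×-dec_; _⊎-dec_; ¬?; dec-true; dec-false; does-⇔)

open ≡-Reasoning

lookup-injective : ∀ {a} {A : Set a} {xs : List A} → Unique xs →
                   ∀ {i j} → lookup xs i ≡ lookup xs j → i ≡ j
lookup-injective {xs = _ ∷ _}  _          {zero}  {zero}  _  = refl
lookup-injective {xs = _ ∷ xs} (x∉ ∷ _)   {zero}  {suc j} eq = ⊥-elim (All.lookup x∉ (∈-lookup {xs = xs} j) eq)
lookup-injective {xs = _ ∷ xs} (x∉ ∷ _)   {suc i} {zero}  eq = ⊥-elim (All.lookup x∉ (∈-lookup {xs = xs} i) (sym eq))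
lookup-injective {xs = _ ∷ _}  (_ ∷ uniq) {suc i} {suc j} eq = cong suc (lookup-injective uniq eq)

unique⇒length≤ : ∀ {n} {xs : List (Fin n)} → Unique xs → length xs ℕ.≤ n
unique⇒length≤ {n} {xs} uniq = ℕP.≮⇒≥ too-long
  where
  too-long : ¬ n < length xs
  too-long n<len with pigeonhole n<len (lookup xs)
  ... | i , j , i<j , eq = ℕP.<-irrefl (cong toℕ (lookup-injective uniq eq)) i<j

module Reachability {n : ℕ} {_~_ : Fin n → Fin n → Set} (_~?_ : Decidable _~_) (p : Fin n) where

  open DecMembership {A = Fin n} _≟_ using (_∈?_)

  Path : Fin n → Set
  Path u = Star _~_ u p

  visited : ∀ {u} → Path u → List (Fin n)
  visited ε                 = []
  visited (_◅_ {j = w} _ π) = w ∷ visited π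

  vertices : ∀ {u} → Path u → List (Fin n)
  vertices {u} π = u ∷ visited π

  SimplePath : Fin n → Set
  SimplePath u = Σ (Path u) (Unique ∘ vertices)

  suffix : ∀ {u w} (π : Path u) → Unique (vertices π) → w ∈ vertices π → SimplePath w
  suffix π       uniq       (here refl) = π , uniq
  suffix (_ ◅ π) (_ ∷ uniq) (there w∈) = suffix π uniq w∈

  erase-loops : ∀ {u} → Path u → SimplePath u
  erase-loops ε = ε , All.[] ∷ []
  erase-loops (_◅_ {i = u} e π) with erase-loops π
  ... | π′ , uniq with u ∈? vertices π′
  ...   | yes u∈ = suffix π′ uniq u∈
  ...   | no  u∉ = e ◅ π′ , ¬Any⇒All¬ (vertices π′) u∉ ∷ uniq

  Within : ℕ → Fin n → Set
  Within zero    u = u ≡ p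
  Within (suc k) u = u ≡ p ⊎ ∃[ w ] u ~ w × Within k w

  within? : ∀ k u → Dec (Within k u)
  within? zero    u = u ≟ p
  within? (suc k) u = u ≟ p ⊎-dec any? (λ w → u ~? w ×-dec within? k w)

  within⇒path : ∀ k {u} → Within k u → Path u
  within⇒path zero    refl               = ε
  within⇒path (suc k) (inj₁ refl)        = ε
  within⇒path (suc k) (inj₂ (_ , e , h)) = e ◅ within⇒path k h

  path⇒within : ∀ {k u} (π : Path u) → length (visited π) ℕ.≤ k → Within k u
  path⇒within {zero}  ε       _         = refl
  path⇒within {suc k} ε       _         = inj₁ refl
  path⇒within {suc k} (e ◅ π) (s≤s len) = inj₂ (_ , e , path⇒within π len)

  -- Loop erasure bounds the search depth by the number of vertices.
  path? : ∀ u → Dec (Path u)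
  path? u = map′ (within⇒path n) short (within? n u)
    where
    short : Path u → Within n u
    short π with erase-loops π
    ... | π′ , uniq = path⇒within π′ (ℕP.<⇒≤ (unique⇒length≤ uniq))

chipsAt : ∀ {m} → ℤ → Fin m → Fin m → ℤ
chipsAt k t w with t ≟ w
... | yes _ = k
... | no  _ = + 0

module _ {k : ℤ} where

  chipsAt-self : ∀ {m} {t : Fin m} → chipsAt k t t ≡ k
  chipsAt-self {t = t} with t ≟ t
  ... | yes _   = refl
  ... | no  t≢t = ⊥-elim (t≢t refl)

  chipsAt-other : ∀ {m} {t w : Fin m} → t ≢ w → chipsAt k t w ≡ + 0
  chipsAt-other {t = t} {w} t≢w with t ≟ w
  ... | yes t≡w = ⊥-elim (t≢w t≡w)
  ... | no  _   = refl

  chipsAt-suc : ∀ {m} (t w : Fin m) → chipsAt k (suc t) (suc w) ≡ chipsAt k t w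
  chipsAt-suc t w = by-cases (t ≟ w)
    where
    by-cases : Dec (t ≡ w) → chipsAt k (suc t) (suc w) ≡ chipsAt k t w
    by-cases (yes refl) = trans chipsAt-self (sym chipsAt-self)
    by-cases (no t≢w)   = trans (chipsAt-other (t≢w ∘ suc-injective)) (sym (chipsAt-other t≢w))

chipsAt-sub-nonneg : ∀ {m} {a b : ℤ} → b ≤ a → ∀ (t w : Fin m) → + 0 ≤ chipsAt a t w - chipsAt b t w
chipsAt-sub-nonneg b≤a t w with t ≟ w
... | yes _ = ℤP.i≤j⇒0≤j-i b≤a
... | no  _ = ℤP.≤-refl

nonneg-sum≡0 : ∀ {x y : ℤ} → + 0 ≤ x → + 0 ≤ y → x + y ≡ + 0 → x ≡ + 0 × y ≡ + 0
nonneg-sum≡0 {+ zero} {+ zero} _ _ _ = refl , refl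

nonneg-sum≡1 : ∀ {x y : ℤ} → + 0 ≤ x → + 0 ≤ y → x + y ≡ + 1 →
               (x ≡ + 0 × y ≡ + 1) ⊎ (x ≡ + 1 × y ≡ + 0)
nonneg-sum≡1 {+ zero}     {+ _}    _ _ sum≡1 = inj₁ (refl , sum≡1)
nonneg-sum≡1 {+ suc zero} {+ zero} _ _ _     = inj₂ (refl , refl)

lcm-pos : ∀ {m n} → 0 < m → 0 < n → 0 < lcm m n
lcm-pos {suc m} {suc n} _ _ = ℕP.n≢0⇒n>0 λ lcm≡0 → ℕP.0≢1+n (begin
  0                         ≡⟨ sym (ℕP.*-zeroʳ g) ⟩
  g ℕ.* 0                   ≡⟨ cong (g ℕ.*_) (sym lcm≡0) ⟩
  g ℕ.* lcm (suc m) (suc n) ≡⟨ gcd*lcm (suc m) (suc n) ⟩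
  suc m ℕ.* suc n           ∎)
  where
  g : ℕ
  g = gcd (suc m) (suc n)

module _ {n : ℕ} (G : Multigraph n) where

  private
    infix 4 _∼ᴳ_
    _∼ᴳ_ : Divisor G → Divisor G → Set
    _∼ᴳ_ = _∼_ G

  sumℤ-cong : ∀ {m} {g h : Fin m → ℤ} → g ≗ h → sumℤ G g ≡ sumℤ G h
  sumℤ-cong {zero}  _   = refl
  sumℤ-cong {suc m} g≗h = cong₂ _+_ (g≗h zero) (sumℤ-cong (g≗h ∘ suc))

  sumℤ-+ : ∀ {m} (g h : Fin m → ℤ) → sumℤ G (λ i → g i + h i) ≡ sumℤ G g + sumℤ G h
  sumℤ-+ {zero}  _ _ = refl
  sumℤ-+ {suc m} g h = trans (cong (_+_ (g zero + h zero)) (sumℤ-+ (g ∘ suc) (h ∘ suc)))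
                             (interchange (g zero) (h zero) _ _)
    where
    interchange : ∀ a b c d → (a + b) + (c + d) ≡ (a + c) + (b + d)
    interchange = solve-∀

  sumℤ-zeros : ∀ {m} {h : Fin m → ℤ} → (∀ i → h i ≡ + 0) → sumℤ G h ≡ + 0
  sumℤ-zeros {zero}  _     = refl
  sumℤ-zeros {suc m} zeros = cong₂ _+_ (zeros zero) (sumℤ-zeros (zeros ∘ suc))

  sumℤ-single : ∀ {m} {h : Fin m → ℤ} t → (∀ i → i ≢ t → h i ≡ + 0) → sumℤ G h ≡ h t
  sumℤ-single {suc m} {h} zero vanish =
    trans (cong (_+_ (h zero)) (sumℤ-zeros (λ i → vanish (suc i) λ ()))) (ℤP.+-identityʳ (h zero))
  sumℤ-single {suc m} {h} (suc t) vanish = begin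
    h zero + sumℤ G (h ∘ suc) ≡⟨ cong (_+ sumℤ G (h ∘ suc)) (vanish zero λ ()) ⟩
    + 0 + sumℤ G (h ∘ suc)    ≡⟨ ℤP.+-identityˡ _ ⟩
    sumℤ G (h ∘ suc)          ≡⟨ sumℤ-single t (λ i i≢t → vanish (suc i) (i≢t ∘ suc-injective)) ⟩
    h (suc t)                 ∎

  sumℤ-chipsAt : ∀ {m} k (t : Fin m) → sumℤ G (chipsAt k t) ≡ k
  sumℤ-chipsAt k t = trans (sumℤ-single t (λ i i≢t → chipsAt-other (i≢t ∘ sym))) chipsAt-self

  sumℤ-nonneg : ∀ {m} {h : Fin m → ℤ} → (∀ i → + 0 ≤ h i) → + 0 ≤ sumℤ G h
  sumℤ-nonneg {zero}  _      = ℤP.≤-refl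
  sumℤ-nonneg {suc m} nonneg = ℤP.+-mono-≤ (nonneg zero) (sumℤ-nonneg (nonneg ∘ suc))

  nonneg-sumℤ≡0 : ∀ {m} {h : Fin m → ℤ} → (∀ i → + 0 ≤ h i) → sumℤ G h ≡ + 0 → ∀ i → h i ≡ + 0
  nonneg-sumℤ≡0 {suc m} nonneg sum≡0 i with nonneg-sum≡0 (nonneg zero) (sumℤ-nonneg (nonneg ∘ suc)) sum≡0
  nonneg-sumℤ≡0 {suc m} nonneg sum≡0 zero    | h₀≡0 , _    = h₀≡0
  nonneg-sumℤ≡0 {suc m} nonneg sum≡0 (suc i) | _ , rest≡0 = nonneg-sumℤ≡0 (nonneg ∘ suc) rest≡0 i

  nonneg-sumℤ≡1 : ∀ {m} {h : Fin m → ℤ} → (∀ i → + 0 ≤ h i) → sumℤ G h ≡ + 1 →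
                  ∃[ v ] h ≗ chipsAt (+ 1) v
  nonneg-sumℤ≡1 {suc m} nonneg sum≡1 with nonneg-sum≡1 (nonneg zero) (sumℤ-nonneg (nonneg ∘ suc)) sum≡1
  ... | inj₂ (h₀≡1 , rest≡0) = zero , λ { zero → h₀≡1 ; (suc i) → nonneg-sumℤ≡0 (nonneg ∘ suc) rest≡0 i }
  ... | inj₁ (h₀≡0 , rest≡1) with nonneg-sumℤ≡1 (nonneg ∘ suc) rest≡1
  ...   | v , h≗v = suc v , λ { zero → h₀≡0 ; (suc i) → trans (h≗v i) (sym (chipsAt-suc v i)) }

  laplacian-+ : ∀ (f g : Fin n → ℤ) w →
                laplacian G (λ u → f u + g u) w ≡ laplacian G f w + laplacian G g w
  laplacian-+ f g w =
    trans (sumℤ-cong (λ u → distrib (+ mult G w u) (f w) (f u) (g w) (g u)))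
          (sumℤ-+ (λ u → + mult G w u * (f w - f u)) (λ u → + mult G w u * (g w - g u)))
    where
    distrib : ∀ m a b c d → m * ((a + c) - (b + d)) ≡ m * (a - b) + m * (c - d)
    distrib = solve-∀

  laplacian-const : ∀ c w → laplacian G (λ _ → c) w ≡ + 0
  laplacian-const c w = sumℤ-zeros λ u →
    trans (cong (+ mult G w u *_) (ℤP.+-inverseʳ c)) (ℤP.*-zeroʳ (+ mult G w u))

  ∼-refl : ∀ {D} → D ∼ᴳ D
  ∼-refl {D} = (λ _ → + 0) , λ v →
    sym (trans (cong (_-_ (D v)) (laplacian-const (+ 0) v)) (ℤP.+-identityʳ (D v)))

  ∼-trans : ∀ {D D′ D″} → D ∼ᴳ D′ → D′ ∼ᴳ D″ → D ∼ᴳ D″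
  ∼-trans {D} {D′} {D″} (f , D′≡) (g , D″≡) = (λ u → f u + g u) , λ v → begin
    D″ v                                            ≡⟨ D″≡ v ⟩
    D′ v - laplacian G g v                          ≡⟨ cong (_- laplacian G g v) (D′≡ v) ⟩
    D v - laplacian G f v - laplacian G g v         ≡⟨ sub-sub (D v) (laplacian G f v) (laplacian G g v) ⟩
    D v - (laplacian G f v + laplacian G g v)       ≡⟨ cong (_-_ (D v)) (sym (laplacian-+ f g v)) ⟩
    D v - laplacian G (λ u → f u + g u) v           ∎
    where
    sub-sub : ∀ a b c → a - b - c ≡ a - (b + c)
    sub-sub = solve-∀

  ∼-sub : ∀ {D D′} (E : Divisor G) → D ∼ᴳ D′ → (λ v → D v - E v) ∼ᴳ (λ v → D′ v - E v)
  ∼-sub {D} {D′} E (f , D′≡) = f , λ v →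
    trans (cong (_- E v) (D′≡ v)) (swap (D v) (laplacian G f v) (E v))
    where
    swap : ∀ a b c → a - b - c ≡ a - c - b
    swap = solve-∀

  adj-sym : ∀ {u w} → Adj G u w → Adj G w u
  adj-sym {u} {w} = subst (0 <_) (symm G u w)

  ¬adj-self : ∀ {u} → ¬ Adj G u u
  ¬adj-self {u} a = ℕP.<-irrefl refl (subst (0 <_) (loopless G u) a)

  AdjWithout : Fin n → Fin n → Fin n → Fin n → Set
  AdjWithout p q u w = Adj G u w × ¬ (u ≡ p × w ≡ q) × ¬ (u ≡ q × w ≡ p)

  adjWithout? : ∀ p q → Decidable (AdjWithout p q)
  adjWithout? p q u w =
    0 ℕP.<? mult G u w ×-dec ¬? (u ≟ p ×-dec w ≟ q) ×-dec ¬? (u ≟ q ×-dec w ≟ p)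

  adjWithout-sym : ∀ {p q u w} → AdjWithout p q u w → AdjWithout p q w u
  adjWithout-sym (a , ¬pq , ¬qp) = adj-sym a , (λ (w≡p , u≡q) → ¬qp (u≡q , w≡p)) , (λ (w≡q , u≡p) → ¬pq (u≡p , w≡q))

  record BunchCut (p q : Fin n) (S : Fin n → Bool) : Set where
    field
      source-in  : S p ≡ true
      target-out : S q ≡ false
      uncut      : ∀ {u w} → AdjWithout p q u w → S u ≡ S w
  open BunchCut

  bunchCut-distinct : ∀ {p q S} → BunchCut p q S → p ≢ q
  bunchCut-distinct cut refl with trans (sym (source-in cut)) (target-out cut)
  ... | ()

  module _ {p q : Fin n} where
    open Reachability (adjWithout? p q) p

    chain-closing : ∀ {u z} → Adj G p z → (π : Path u) → Chain G (u ∷ visited π ++ z ∷ [])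
    chain-closing pz ε             = pz , tt
    chain-closing pz ((a , _) ◅ π) = a , chain-closing pz π

    -- A simple path from q to p avoiding the bunch has at least two edges, so the bunch closes a cycle.
    simplePath⇒cycle : Adj G p q → SimplePath q → HasCycle G
    simplePath⇒cycle pq (ε , _)                  = ⊥-elim (¬adj-self pq)
    simplePath⇒cycle pq ((_ , _ , ¬qp) ◅ ε , _)  = ⊥-elim (¬qp (refl , refl))
    simplePath⇒cycle pq (π@(_ ◅ _ ◅ _) , uniq) = q , visited π , s≤s (s≤s z≤n) , uniq , chain-closing pq π

    acyclic⇒bunchCut : ¬ HasCycle G → Adj G p q → ∃[ S ] BunchCut p q S
    acyclic⇒bunchCut acyclic pq = (λ u → does (path? u)) , record
      { source-in  = dec-true (path? p) ε
      ; target-out = dec-false (path? q) (acyclic ∘ simplePath⇒cycle pq ∘ erase-loops)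
      ; uncut      = λ e → does-⇔ (mk⇔ (adjWithout-sym e ◅_) (e ◅_)) (path? _) (path? _)
      }

  indicator : (Fin n → Bool) → ℤ → Fin n → ℤ
  indicator S c u = if S u then c else + 0

  module _ {p q : Fin n} {S : Fin n → Bool} (cut : BunchCut p q S) (c : ℤ) where

    private
      f : Fin n → ℤ
      f = indicator S c

      K : ℤ
      K = + mult G p q * c

      p≢q : p ≢ q
      p≢q = bunchCut-distinct cut

      f-source : f p ≡ c
      f-source = cong (if_then c else + 0) (source-in cut)

      f-target : f q ≡ + 0
      f-target = cong (if_then c else + 0) (target-out cut)

    laplacian-term-off-bunch : ∀ {w u} → ¬ (w ≡ p × u ≡ q) → ¬ (w ≡ q × u ≡ p) →
                               + mult G w u * (f w - f u) ≡ + 0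
    laplacian-term-off-bunch {w} {u} ¬pq ¬qp with mult G w u in m≡
    ... | zero  = refl
    ... | suc k = begin
      + suc k * (f w - f u) ≡⟨ cong (λ b → + suc k * ((if b then c else + 0) - f u)) (uncut cut (adj , ¬pq , ¬qp)) ⟩
      + suc k * (f u - f u) ≡⟨ cong (+ suc k *_) (ℤP.+-inverseʳ (f u)) ⟩
      + suc k * + 0         ≡⟨ ℤP.*-zeroʳ (+ suc k) ⟩
      + 0                   ∎
      where
      adj : Adj G w u
      adj = subst (0 <_) (sym m≡) (s≤s z≤n)

    laplacian-indicator : ∀ w → laplacian G f w ≡ chipsAt K p w - chipsAt K q w
    laplacian-indicator w with w ≟ p | w ≟ q
    ... | yes refl | _ = begin
      laplacian G f w               ≡⟨ sumℤ-single q (λ u u≢q → laplacian-term-off-bunch (λ (_ , u≡q) → u≢q u≡q) (p≢q ∘ proj₁)) ⟩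
      + mult G w q * (f w - f q)    ≡⟨ cong₂ (λ a b → + mult G w q * (a - b)) f-source f-target ⟩
      + mult G w q * (c - + 0)      ≡⟨ cong (+ mult G w q *_) (ℤP.+-identityʳ c) ⟩
      K                             ≡⟨ sym (ℤP.+-identityʳ K) ⟩
      K - + 0                       ≡⟨ cong₂ _-_ (sym (chipsAt-self {k = K} {t = w})) (sym (chipsAt-other {k = K} (p≢q ∘ sym))) ⟩
      chipsAt K w w - chipsAt K q w ∎
    ... | no _ | yes refl = begin
      laplacian G f w               ≡⟨ sumℤ-single p (λ u u≢p → laplacian-term-off-bunch (p≢q ∘ sym ∘ proj₁) (λ (_ , u≡p) → u≢p u≡p)) ⟩
      + mult G w p * (f w - f p)    ≡⟨ cong₂ (λ a b → + mult G w p * (a - b)) f-target f-source ⟩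
      + mult G w p * (+ 0 - c)      ≡⟨ cong (λ a → + a * (+ 0 - c)) (symm G w p) ⟩
      + mult G p w * (+ 0 - c)      ≡⟨ negate (+ mult G p w) c ⟩
      + 0 - K                       ≡⟨ cong₂ _-_ (sym (chipsAt-other {k = K} p≢q)) (sym (chipsAt-self {k = K})) ⟩
      chipsAt K p w - chipsAt K w w ∎
      where
      negate : ∀ a b → a * (+ 0 - b) ≡ + 0 - a * b
      negate = solve-∀
    ... | no w≢p | no w≢q = begin
      laplacian G f w               ≡⟨ sumℤ-zeros (λ u → laplacian-term-off-bunch {u = u} (w≢p ∘ proj₁) (w≢q ∘ proj₁)) ⟩
      + 0 - + 0                     ≡⟨ cong₂ _-_ (sym (chipsAt-other {k = K} (w≢p ∘ sym))) (sym (chipsAt-other {k = K} (w≢q ∘ sym))) ⟩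
      chipsAt K p w - chipsAt K q w ∎

    bunchCut-firing : chipsAt K p ∼ᴳ chipsAt K q
    bunchCut-firing = f , λ w → begin
      chipsAt K q w                                       ≡⟨ sub-sub (chipsAt K p w) (chipsAt K q w) ⟩
      chipsAt K p w - (chipsAt K p w - chipsAt K q w)     ≡⟨ cong (_-_ (chipsAt K p w)) (sym (laplacian-indicator w)) ⟩
      chipsAt K p w - laplacian G f w                     ∎
      where
      sub-sub : ∀ a b → b ≡ a - (a - b)
      sub-sub = solve-∀

  adjacent-chipsAt-∼ : ∀ {p q K} → ¬ HasCycle G → Adj G p q → mult G p q ∣ K →
                       chipsAt (+ K) p ∼ᴳ chipsAt (+ K) q
  adjacent-chipsAt-∼ {p} {q} acyclic pq (divides c refl) with acyclic⇒bunchCut acyclic pq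
  ... | S , cut = subst (λ K → chipsAt K p ∼ᴳ chipsAt K q) K≡ (bunchCut-firing cut (+ c))
    where
    K≡ : + mult G p q * + c ≡ + (c ℕ.* mult G p q)
    K≡ = trans (sym (ℤP.pos-* (mult G p q) c)) (cong +_ (ℕP.*-comm (mult G p q) c))

  walk⇒chipsAt-∼ : ∀ {K u v} → ¬ HasCycle G → (∀ {u w} → Adj G u w → mult G u w ∣ K) →
                   Walk G u v → chipsAt (+ K) u ∼ᴳ chipsAt (+ K) v
  walk⇒chipsAt-∼ acyclic bunch∣K here = ∼-refl
  walk⇒chipsAt-∼ {K} {u} acyclic bunch∣K (step a π) =
    ∼-trans {D = chipsAt (+ K) u} (adjacent-chipsAt-∼ acyclic a (bunch∣K a))
                                  (walk⇒chipsAt-∼ acyclic bunch∣K π)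

  ∣-lcmFin : ∀ {m} (g : Fin m → ℕ) i → g i ∣ lcmFin G g
  ∣-lcmFin g zero    = m∣lcm[m,n] _ _
  ∣-lcmFin g (suc i) = ∣-trans (∣-lcmFin (g ∘ suc) i) (n∣lcm[m,n] (g zero) _)

  lcmFin-pos : ∀ {m} (g : Fin m → ℕ) → (∀ i → 0 < g i) → 0 < lcmFin G g
  lcmFin-pos {zero}  g _   = s≤s z≤n
  lcmFin-pos {suc m} g pos = lcm-pos (pos zero) (lcmFin-pos (g ∘ suc) (pos ∘ suc))

  bunchEntry : Fin n → Fin n → ℕ
  bunchEntry u v = if (toℕ u <ᵇ toℕ v) ∧ not (mult G u v ≡ᵇ 0) then mult G u v else 1

  bunchEntry∣bunchLcm : ∀ u v → bunchEntry u v ∣ bunchLcm G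
  bunchEntry∣bunchLcm u v = ∣-trans (∣-lcmFin (bunchEntry u) v) (∣-lcmFin (λ u → lcmFin G (bunchEntry u)) u)

  bunchEntry-pos : ∀ u v → 0 < bunchEntry u v
  bunchEntry-pos u v = guarded-pos (toℕ u <ᵇ toℕ v) (mult G u v)
    where
    guarded-pos : ∀ b m → 0 < (if b ∧ not (m ≡ᵇ 0) then m else 1)
    guarded-pos false _       = s≤s z≤n
    guarded-pos true  zero    = s≤s z≤n
    guarded-pos true  (suc _) = s≤s z≤n

  bunchEntry-ordered : ∀ {u v} → toℕ u < toℕ v → Adj G u v → bunchEntry u v ≡ mult G u v
  bunchEntry-ordered {u} {v} u<v = guarded-selects (ℕP.<⇒<ᵇ u<v)
    where
    guarded-selects : ∀ {b m} → T b → 0 < m → (if b ∧ not (m ≡ᵇ 0) then m else 1) ≡ m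
    guarded-selects {true} {suc _} _ _ = refl

  bunchLcm-pos : 0 < bunchLcm G
  bunchLcm-pos = lcmFin-pos _ (λ u → lcmFin-pos _ (bunchEntry-pos u))

  bunch∣bunchLcm : ∀ {u v} → Adj G u v → mult G u v ∣ bunchLcm G
  bunch∣bunchLcm {u} {v} a with ℕP.<-cmp (toℕ u) (toℕ v)
  ... | tri< u<v _ _ = subst (_∣ bunchLcm G) (bunchEntry-ordered u<v a) (bunchEntry∣bunchLcm u v)
  ... | tri≈ _ u≡v _ = ⊥-elim (¬adj-self (subst (Adj G u) (sym (toℕ-injective u≡v)) a))
  ... | tri> _ _ v<u = subst (_∣ bunchLcm G) (trans (bunchEntry-ordered v<u (adj-sym a)) (symm G v u))
                             (bunchEntry∣bunchLcm v u)

lemma2p6 : ∀ (n : ℕ) (G : Multigraph n) → IsBananaTree G → gon≤ G (+ bunchLcm G)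
lemma2p6 zero    G (() , _)
lemma2p6 (suc n) G (_ , connected , acyclic) =
  chipsAt (+ L) zero , positive-rank , ℤP.≤-reflexive (sumℤ-chipsAt G (+ L) (zero {n}))
  where
  L : ℕ
  L = bunchLcm G

  positive-rank : HasPositiveRank G (chipsAt (+ L) zero)
  positive-rank E E≥0 deg≡1 with nonneg-sumℤ≡1 G E≥0 deg≡1
  ... | v , E≗v = (λ w → chipsAt (+ L) v w - E w) , effective , ∼-sub G {D = chipsAt (+ L) zero} E L·r∼L·v
    where
    L·r∼L·v : _∼_ G (chipsAt (+ L) zero) (chipsAt (+ L) v)
    L·r∼L·v = walk⇒chipsAt-∼ G acyclic (bunch∣bunchLcm G) (connected zero v)

    effective : Effective G (λ w → chipsAt (+ L) v w - E w)
    effective w rewrite E≗v w = chipsAt-sub-nonneg (+≤+ (bunchLcm-pos G)) v w
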